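{- Let $t$ be a binary tree whose nodes are partitioned into micro trees by the Farzan–Munro algorithm, let $u,v$ be nodes of $t$, and let $\mu_u,\mu_v$ be the micro trees containing them. (1) If $\mu_u=\mu_v$, then $\mathrm{lca}(u,v)$ equals the lowest common ancestor of $u,v$ within the micro tree $\mu_u$. (2) If $\mu_u\ne\mu_v$, let $\mu$ be the lowest common ancestor of $\mu_u$ and $\mu_v$ in the top-tier tree. If $\mu\notin\{\mu_u,\mu_v\}$, then $\mu$ consists of a single node $x$, and $\mathrm{lca}(u,v)=x$. If $\mu=\mu_u$ (the case $\mu=\mu_v$ is symmetric), let $x$ be the node of $\mu_u$ that is the parent of the root of the child micro tree of $\mu_u$ which is an ancestor of (or equal to) $\mu_v$ in the top-tier tree; then $\mathrm{lca}(u,v)$ equals the lowest common ancestor of $x$ and $u$ within $\mu_u$.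
   Context: A binary tree is a rooted tree where each node has a left and a right child slot, each possibly empty; $\mathrm{lca}(u,v)$ is the lowest common ancestor in $t$ (a node is an ancestor of itself). The Farzan–Munro algorithm partitions the nodes of a binary tree into disjoint micro trees, each a connected set of nodes rooted at its topmost node; a child micro tree of $\mu$ is a micro tree whose root's parent lies in $\mu$. It is known that contracting each micro tree into a single node yields a binary tree, the top-tier tree (whose parent–child relation is the child-micro-tree relation), and that any micro tree with two child micro trees consists of a single node. -}

module Defs where

open import Data.Nat using (ℕ)
open import Data.Sum using (_⊎_)
open import Data.Product using (Σ; ∃; _×_; _,_)
open import Relation.Binary.PropositionalEquality using (_≡_)
open import Relation.Nullary using (¬_)
open import Relation.Binary.Construct.Closure.ReflexiveTransitive using (Star)

-- Shapes of binary trees: every node has a left and a right child slot,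
-- each possibly empty ('leaf' = empty slot / empty tree).
data Tree : Set where
  leaf : Tree
  node : Tree → Tree → Tree

data Pos : Tree → Set where
  here : ∀ {l r} → Pos (node l r)
  goL  : ∀ {l r} → Pos l → Pos (node l r)
  goR  : ∀ {l r} → Pos r → Pos (node l r)

data _≼_ : ∀ {t} → Pos t → Pos t → Set where
  here≼ : ∀ {l r} {q : Pos (node l r)} → here ≼ q
  goL≼  : ∀ {l r} {p q : Pos l} → p ≼ q → goL {l} {r} p ≼ goL q
  goR≼  : ∀ {l r} {p q : Pos r} → p ≼ q → goR {l} {r} p ≼ goR q

data _⋖_ : ∀ {t} → Pos t → Pos t → Set where
  here⋖L : ∀ {a b r} → here {node a b} {r} ⋖ goL here
  here⋖R : ∀ {l a b} → here {l} {node a b} ⋖ goR here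
  goL⋖   : ∀ {l r} {p c : Pos l} → p ⋖ c → goL {l} {r} p ⋖ goL c
  goR⋖   : ∀ {l r} {p c : Pos r} → p ⋖ c → goR {l} {r} p ⋖ goR c

lca : ∀ {t} → Pos t → Pos t → Pos t
lca here    _       = here
lca (goL p) here    = here
lca (goL p) (goL q) = goL (lca p q)
lca (goL p) (goR q) = here
lca (goR p) here    = here
lca (goR p) (goL q) = here
lca (goR p) (goR q) = goR (lca p q)

module _ {t : Tree} (mt : Pos t → ℕ) where
  -- mt assigns to every node (the label of) the micro tree containing it;
  -- micro trees are the fibres of mt.

  IsMicroRoot : Pos t → Set
  IsMicroRoot u = ∀ p → p ⋖ u → ¬ (mt p ≡ mt u)

  ChildMT : ℕ → ℕ → Set
  ChildMT μ μ' = Σ (Pos t) λ p → Σ (Pos t) λ r →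
    p ⋖ r × mt p ≡ μ × mt r ≡ μ' × ¬ (μ ≡ μ')

  _≼T_ : ℕ → ℕ → Set
  μ ≼T μ' = Star ChildMT μ μ'

  IsTopLCA : ℕ → ℕ → ℕ → Set
  IsTopLCA μ₁ μ₂ μ = μ ≼T μ₁ × μ ≼T μ₂ × (∀ μ' → μ' ≼T μ₁ → μ' ≼T μ₂ → μ' ≼T μ)

  -- w is the lowest common ancestor of a and b within the micro tree μ
  -- (a connected subtree of t, whose ancestor relation is that of t).
  IsLCAIn : ℕ → Pos t → Pos t → Pos t → Set
  IsLCAIn μ a b w = mt w ≡ μ × w ≼ a × w ≼ b ×
    (∀ w' → mt w' ≡ μ → w' ≼ a → w' ≼ b → w' ≼ w)

  ParentOfChildToward : ℕ → ℕ → Pos t → Set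
  ParentOfChildToward μ ν x = Σ (Pos t) λ r →
    x ⋖ r × mt x ≡ μ × ¬ (mt r ≡ μ) × mt r ≼T ν

  record FMPartition : Set where
    field
      -- each micro tree is a connected set rooted at its unique topmost node
      connected : ∀ u v → mt u ≡ mt v → IsMicroRoot u → IsMicroRoot v → u ≡ v
      binaryTop : ∀ μ μ₁ μ₂ μ₃ → ChildMT μ μ₁ → ChildMT μ μ₂ → ChildMT μ μ₃ →
                  μ₁ ≡ μ₂ ⊎ μ₁ ≡ μ₃ ⊎ μ₂ ≡ μ₃
      twoChildrenSingleton : ∀ μ μ₁ μ₂ → ChildMT μ μ₁ → ChildMT μ μ₂ → ¬ (μ₁ ≡ μ₂) →
                  ∀ a b → mt a ≡ μ → mt b ≡ μ → a ≡ b

{-# OPTIONS --safe #-}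
-- Walking down from the root of t and starting a new micro root whenever the
-- label changes shows that every node a lies below a micro root whose path to
-- a stays in the micro tree of a. As micro roots are unique, micro trees are
-- convex, and a top-tier ancestor of μ' has its micro root above every node
-- of μ'. Part (1) follows by convexity. In part (2), if μ ∉ {μ_u, μ_v}, the
-- children of μ towards μ_u and μ_v are distinct (otherwise the one towards
-- μ_u would be a common top-tier ancestor below μ, closing a cycle), so μ is
-- a single node x, and u, v lie below distinct children of x. If μ = μ_u, v
-- lies below the child r of x that roots a micro tree towards μ_v, while u
-- does not (by convexity it would be in μ_u), so lca(u, v) = lca(x, u).
module Submission where

open import Defs
open import Data.Nat using (ℕ; _≟_)
open import Data.Product using (Σ; _×_; _,_)
open import Data.Sum using (_⊎_; inj₁; inj₂)
import Data.Sum as Sum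
open import Data.Empty using (⊥-elim)
open import Relation.Binary.PropositionalEquality using (_≡_; refl; sym; trans; cong; subst)
open import Relation.Nullary using (¬_; yes; no)
open import Relation.Binary.Construct.Closure.ReflexiveTransitive using (Star; ε; _◅_; gmap)

private
  variable
    t : Tree
    a b c p r u v w x y ρ : Pos t

≼-refl : a ≼ a
≼-refl {a = here}  = here≼
≼-refl {a = goL a} = goL≼ ≼-refl
≼-refl {a = goR a} = goR≼ ≼-refl

≼-trans : a ≼ b → b ≼ c → a ≼ c
≼-trans here≼     _         = here≼
≼-trans (goL≼ h) (goL≼ h′) = goL≼ (≼-trans h h′)
≼-trans (goR≼ h) (goR≼ h′) = goR≼ (≼-trans h h′)

≼-antisym : a ≼ b → b ≼ a → a ≡ b
≼-antisym here≼     here≼     = refl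
≼-antisym (goL≼ h) (goL≼ h′) = cong goL (≼-antisym h h′)
≼-antisym (goR≼ h) (goR≼ h′) = cong goR (≼-antisym h h′)

⋖⇒≼ : p ⋖ c → p ≼ c
⋖⇒≼ here⋖L   = here≼
⋖⇒≼ here⋖R   = here≼
⋖⇒≼ (goL⋖ h) = goL≼ (⋖⇒≼ h)
⋖⇒≼ (goR⋖ h) = goR≼ (⋖⇒≼ h)

⋖⇒⋡ : p ⋖ c → ¬ (c ≼ p)
⋖⇒⋡ (goL⋖ h) (goL≼ h′) = ⋖⇒⋡ h h′
⋖⇒⋡ (goR⋖ h) (goR≼ h′) = ⋖⇒⋡ h h′

⋖-unique : p ⋖ c → r ⋖ c → p ≡ r
⋖-unique here⋖L   here⋖L    = refl
⋖-unique here⋖R   here⋖R    = refl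
⋖-unique (goL⋖ h) (goL⋖ h′) = cong goL (⋖-unique h h′)
⋖-unique (goR⋖ h) (goR⋖ h′) = cong goR (⋖-unique h h′)

≼⋖⇒≡⊎≼ : y ≼ c → p ⋖ c → y ≡ c ⊎ y ≼ p
≼⋖⇒≡⊎≼ here≼        here⋖L   = inj₂ here≼
≼⋖⇒≡⊎≼ (goL≼ here≼) here⋖L   = inj₁ refl
≼⋖⇒≡⊎≼ here≼        here⋖R   = inj₂ here≼
≼⋖⇒≡⊎≼ (goR≼ here≼) here⋖R   = inj₁ refl
≼⋖⇒≡⊎≼ here≼        (goL⋖ h) = inj₂ here≼
≼⋖⇒≡⊎≼ (goL≼ y≼c)   (goL⋖ h) = Sum.map (cong goL) goL≼ (≼⋖⇒≡⊎≼ y≼c h)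
≼⋖⇒≡⊎≼ here≼        (goR⋖ h) = inj₂ here≼
≼⋖⇒≡⊎≼ (goR≼ y≼c)   (goR⋖ h) = Sum.map (cong goR) goR≼ (≼⋖⇒≡⊎≼ y≼c h)

here⋖⋆ : ∀ {l r} (a : Pos (node l r)) → Star _⋖_ here a
here⋖⋆ here                   = ε
here⋖⋆ (goL {node _ _} a)     = here⋖L ◅ gmap goL goL⋖ (here⋖⋆ a)
here⋖⋆ (goR {_} {node _ _} a) = here⋖R ◅ gmap goR goR⋖ (here⋖⋆ a)

lca-≼ˡ : (a b : Pos t) → lca a b ≼ a
lca-≼ˡ here    _       = here≼
lca-≼ˡ (goL a) here    = here≼
lca-≼ˡ (goL a) (goL b) = goL≼ (lca-≼ˡ a b)
lca-≼ˡ (goL a) (goR b) = here≼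
lca-≼ˡ (goR a) here    = here≼
lca-≼ˡ (goR a) (goL b) = here≼
lca-≼ˡ (goR a) (goR b) = goR≼ (lca-≼ˡ a b)

lca-≼ʳ : (a b : Pos t) → lca a b ≼ b
lca-≼ʳ here    _       = here≼
lca-≼ʳ (goL a) here    = here≼
lca-≼ʳ (goL a) (goL b) = goL≼ (lca-≼ʳ a b)
lca-≼ʳ (goL a) (goR b) = here≼
lca-≼ʳ (goR a) here    = here≼
lca-≼ʳ (goR a) (goL b) = here≼
lca-≼ʳ (goR a) (goR b) = goR≼ (lca-≼ʳ a b)

lca-greatest : w ≼ a → w ≼ b → w ≼ lca a b
lca-greatest here≼     _         = here≼
lca-greatest (goL≼ h) (goL≼ h′) = goL≼ (lca-greatest h h′)
lca-greatest (goR≼ h) (goR≼ h′) = goR≼ (lca-greatest h h′)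

lca-comm : (a b : Pos t) → lca a b ≡ lca b a
lca-comm a b = ≼-antisym (lca-greatest (lca-≼ʳ a b) (lca-≼ˡ a b))
                         (lca-greatest (lca-≼ʳ b a) (lca-≼ˡ b a))

lca-outside-subtree : x ⋖ r → r ≼ v → ¬ (r ≼ u) → lca u v ≡ lca x u
lca-outside-subtree {u = here}  here⋖L (goL≼ _) _   = refl
lca-outside-subtree {u = goL u} here⋖L (goL≼ _) r⋠u = ⊥-elim (r⋠u (goL≼ here≼))
lca-outside-subtree {u = goR u} here⋖L (goL≼ _) _   = refl
lca-outside-subtree {u = here}  here⋖R (goR≼ _) _   = refl
lca-outside-subtree {u = goL u} here⋖R (goR≼ _) _   = refl
lca-outside-subtree {u = goR u} here⋖R (goR≼ _) r⋠u = ⊥-elim (r⋠u (goR≼ here≼))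
lca-outside-subtree {u = here}  (goL⋖ h) (goL≼ r≼v) _ = refl
lca-outside-subtree {u = goL u} (goL⋖ h) (goL≼ r≼v) r⋠u =
  cong goL (lca-outside-subtree h r≼v (λ r≼u → r⋠u (goL≼ r≼u)))
lca-outside-subtree {u = goR u} (goL⋖ h) (goL≼ r≼v) _ = refl
lca-outside-subtree {u = here}  (goR⋖ h) (goR≼ r≼v) _ = refl
lca-outside-subtree {u = goL u} (goR⋖ h) (goR≼ r≼v) _ = refl
lca-outside-subtree {u = goR u} (goR⋖ h) (goR≼ r≼v) r⋠u =
  cong goR (lca-outside-subtree h r≼v (λ r≼u → r⋠u (goR≼ r≼u)))

lca-sibling-subtrees : x ⋖ a → x ⋖ b → ¬ (a ≡ b) → a ≼ u → b ≼ v → lca u v ≡ x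
lca-sibling-subtrees here⋖L here⋖L a≢b _ _ = ⊥-elim (a≢b refl)
lca-sibling-subtrees here⋖R here⋖R a≢b _ _ = ⊥-elim (a≢b refl)
lca-sibling-subtrees here⋖L here⋖R _ (goL≼ _) (goR≼ _) = refl
lca-sibling-subtrees here⋖R here⋖L _ (goR≼ _) (goL≼ _) = refl
lca-sibling-subtrees (goL⋖ h) (goL⋖ h′) a≢b (goL≼ a≼u) (goL≼ b≼v) =
  cong goL (lca-sibling-subtrees h h′ (λ e → a≢b (cong goL e)) a≼u b≼v)
lca-sibling-subtrees (goR⋖ h) (goR⋖ h′) a≢b (goR≼ a≼u) (goR≼ b≼v) =
  cong goR (lca-sibling-subtrees h h′ (λ e → a≢b (cong goR e)) a≼u b≼v)

module Labelling {t : Tree} (mt : Pos t → ℕ) where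

  ⋖-microRoot : p ⋖ r → ¬ (mt p ≡ mt r) → IsMicroRoot mt r
  ⋖-microRoot p⋖r p≁r q q⋖r q∼r with ⋖-unique p⋖r q⋖r
  ... | refl = p≁r q∼r

  record MicroPath (a : Pos t) : Set where
    field
      top             : Pos t
      top-isMicroRoot : IsMicroRoot mt top
      top≼            : top ≼ a
      uniform         : top ≼ y → y ≼ a → mt y ≡ mt a

    top-label : mt top ≡ mt a
    top-label = uniform ≼-refl top≼

  microPath-self : IsMicroRoot mt a → MicroPath a
  microPath-self a-isMicroRoot = record
    { top = _ ; top-isMicroRoot = a-isMicroRoot ; top≼ = ≼-refl
    ; uniform = λ a≼y y≼a → cong mt (≼-antisym y≼a a≼y) }

  microPath-⋖ : c ⋖ r → MicroPath c → MicroPath r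
  microPath-⋖ {c} {r} c⋖r path with mt c ≟ mt r
  ... | yes c∼r = record
    { top = top ; top-isMicroRoot = top-isMicroRoot ; top≼ = ≼-trans top≼ (⋖⇒≼ c⋖r)
    ; uniform = λ top≼y y≼r → extend (≼⋖⇒≡⊎≼ y≼r c⋖r) top≼y }
    where
    open MicroPath path
    extend : y ≡ r ⊎ y ≼ c → top ≼ y → mt y ≡ mt r
    extend (inj₁ refl) _    = refl
    extend (inj₂ y≼c) top≼y = trans (uniform top≼y y≼c) c∼r
  ... | no c≁r = microPath-self (⋖-microRoot c⋖r c≁r)

  microPath-⋖⋆ : Star _⋖_ c a → MicroPath c → MicroPath a
  microPath-⋖⋆ ε        path = path
  microPath-⋖⋆ (h ◅ hs) path = microPath-⋖⋆ hs (microPath-⋖ h path)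

  -- Matching on a is what reveals t to be a node, so that here : Pos t.
  microPath : (a : Pos t) → MicroPath a
  microPath here      = microPath-self λ _ ()
  microPath a@(goL _) = microPath-⋖⋆ (here⋖⋆ a) (microPath-self λ _ ())
  microPath a@(goR _) = microPath-⋖⋆ (here⋖⋆ a) (microPath-self λ _ ())

module Partition {t : Tree} {mt : Pos t → ℕ} (fm : FMPartition mt) where
  open FMPartition fm
  open Labelling mt

  microRoot≼ : IsMicroRoot mt ρ → mt ρ ≡ mt w → ρ ≼ w
  microRoot≼ {ρ = ρ} {w = w} ρ-isMicroRoot ρ∼w =
    subst (_≼ w) (connected top ρ (trans top-label (sym ρ∼w)) top-isMicroRoot ρ-isMicroRoot) top≼
    where open MicroPath (microPath w)

  microTree-convex : mt a ≡ mt b → a ≼ y → y ≼ b → mt y ≡ mt b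
  microTree-convex {a = a} {b = b} a∼b a≼y y≼b =
    uniform (≼-trans (microRoot≼ top-isMicroRoot (trans top-label (sym a∼b))) a≼y) y≼b
    where open MicroPath (microPath b)

  lca-isLCAIn : ∀ {μ} → mt a ≡ μ → mt b ≡ μ → IsLCAIn mt μ a b (lca a b)
  lca-isLCAIn {a = a} {b = b} refl b∼a =
    microTree-convex top-label (lca-greatest top≼ top≼b) (lca-≼ˡ a b)
      , lca-≼ˡ a b , lca-≼ʳ a b , λ _ _ → lca-greatest
    where
    open MicroPath (microPath a)
    top≼b : top ≼ b
    top≼b = microRoot≼ top-isMicroRoot (trans top-label (sym b∼a))

  topTier≼⇒≼ : ∀ {μ ν} → Star (ChildMT mt) μ ν → IsMicroRoot mt ρ → mt ρ ≡ μ → mt w ≡ ν → ρ ≼ w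
  topTier≼⇒≼ ε ρ-isMicroRoot ρ∈μ w∈μ = microRoot≼ ρ-isMicroRoot (trans ρ∈μ (sym w∈μ))
  topTier≼⇒≼ ((p , r , p⋖r , refl , refl , μ≢μ′) ◅ s) ρ-isMicroRoot ρ∈μ w∈ν =
    ≼-trans (microRoot≼ ρ-isMicroRoot ρ∈μ)
            (≼-trans (⋖⇒≼ p⋖r) (topTier≼⇒≼ s (⋖-microRoot p⋖r μ≢μ′) refl w∈ν))

  topTier-acyclic : ∀ {μ μ′} → ChildMT mt μ μ′ → ¬ Star (ChildMT mt) μ′ μ
  topTier-acyclic (p , r , p⋖r , refl , refl , μ≢μ′) s =
    ⋖⇒⋡ p⋖r (topTier≼⇒≼ s (⋖-microRoot p⋖r μ≢μ′) refl refl)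

  lca-below-distinct-children : ∀ {μ μ₁ μ₂} → ChildMT mt μ μ₁ → ChildMT mt μ μ₂ → ¬ (μ₁ ≡ μ₂) →
    Star (ChildMT mt) μ₁ (mt u) → Star (ChildMT mt) μ₂ (mt v) →
    Σ (Pos t) λ x → mt x ≡ μ × (∀ y → mt y ≡ μ → y ≡ x) × lca u v ≡ x
  lca-below-distinct-children
    c₁@(p₁ , r₁ , p₁⋖r₁ , refl , refl , μ≢μ₁) c₂@(p₂ , r₂ , p₂⋖r₂ , p₂∈μ , refl , μ≢μ₂) μ₁≢μ₂ s₁ s₂ =
    p₁ , refl , (λ y y∈μ → singleton y p₁ y∈μ refl) ,
    lca-sibling-subtrees p₁⋖r₁ p₁⋖r₂ (λ r₁≡r₂ → μ₁≢μ₂ (cong mt r₁≡r₂))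
      (topTier≼⇒≼ s₁ (⋖-microRoot p₁⋖r₁ μ≢μ₁) refl refl)
      (topTier≼⇒≼ s₂ (⋖-microRoot p₁⋖r₂ μ≢μ₂) refl refl)
    where
    singleton : ∀ a b → mt a ≡ mt p₁ → mt b ≡ mt p₁ → a ≡ b
    singleton = twoChildrenSingleton (mt p₁) (mt r₁) (mt r₂) c₁ c₂ μ₁≢μ₂
    p₁⋖r₂ : p₁ ⋖ r₂
    p₁⋖r₂ = subst (_⋖ r₂) (singleton p₂ p₁ p₂∈μ refl) p₂⋖r₂

  topLCA-singleton : ∀ {μ} → IsTopLCA mt (mt u) (mt v) μ → ¬ (μ ≡ mt u) → ¬ (μ ≡ mt v) →
    Σ (Pos t) λ x → mt x ≡ μ × (∀ y → mt y ≡ μ → y ≡ x) × lca u v ≡ x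
  topLCA-singleton (ε , _ , _) μ≢μᵤ _ = ⊥-elim (μ≢μᵤ refl)
  topLCA-singleton (_ ◅ _ , ε , _) _ μ≢μᵥ = ⊥-elim (μ≢μᵥ refl)
  topLCA-singleton {v = v} (_◅_ {j = μ₁} c₁ s₁ , _◅_ {j = μ₂} c₂ s₂ , lowest) _ _ =
    lca-below-distinct-children c₁ c₂ μ₁≢μ₂ s₁ s₂
    where
    μ₁≢μ₂ : ¬ (μ₁ ≡ μ₂)
    μ₁≢μ₂ μ₁≡μ₂ = topTier-acyclic c₁
      (lowest _ s₁ (subst (λ μ → Star (ChildMT mt) μ (mt v)) (sym μ₁≡μ₂) s₂))

  parentToward-isLCAIn : ParentOfChildToward mt (mt u) (mt v) x → IsLCAIn mt (mt u) x u (lca u v)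
  parentToward-isLCAIn {u = u} {v = v} {x = x} (r , x⋖r , x∈μᵤ , r∉μᵤ , s) =
    subst (IsLCAIn mt (mt u) x u) (sym (lca-outside-subtree x⋖r r≼v r⋠u)) (lca-isLCAIn x∈μᵤ refl)
    where
    r≼v : r ≼ v
    r≼v = topTier≼⇒≼ s (⋖-microRoot x⋖r (λ x∼r → r∉μᵤ (trans (sym x∼r) x∈μᵤ))) refl refl
    r⋠u : ¬ (r ≼ u)
    r⋠u r≼u = r∉μᵤ (microTree-convex x∈μᵤ (⋖⇒≼ x⋖r) r≼u)

proposition19 : (t : Tree) (mt : Pos t → ℕ) → FMPartition mt → (u v : Pos t) →
    (mt u ≡ mt v → IsLCAIn mt (mt u) u v (lca u v)) ×
    (¬ (mt u ≡ mt v) → (μ : ℕ) → IsTopLCA mt (mt u) (mt v) μ →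
      (¬ (μ ≡ mt u) → ¬ (μ ≡ mt v) →
        Σ (Pos t) λ x → mt x ≡ μ × (∀ y → mt y ≡ μ → y ≡ x) × lca u v ≡ x) ×
      (μ ≡ mt u → ∀ x → ParentOfChildToward mt (mt u) (mt v) x →
        IsLCAIn mt (mt u) x u (lca u v)) ×
      (μ ≡ mt v → ∀ x → ParentOfChildToward mt (mt v) (mt u) x →
        IsLCAIn mt (mt v) x v (lca u v)))
proposition19 t mt fm u v =
  (λ μᵤ≡μᵥ → lca-isLCAIn refl (sym μᵤ≡μᵥ)) ,
  λ _ μ isTopLCA →
    topLCA-singleton isTopLCA ,
    (λ _ _ → parentToward-isLCAIn) ,
    (λ _ x toward → subst (IsLCAIn mt (mt v) x v) (lca-comm v u) (parentToward-isLCAIn toward))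
  where open Partition fm
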